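{- Let $\mathcal{T}$ be a rooted tree admitting an actual labelling $(l,l_p)$. Then for all vertices $p,q$ of $\mathcal{T}$ with $l(p)=l(q)$ we have $\mathcal{T}^p\cong\mathcal{T}^q$. In particular $\mathcal{T}$ is cocompact.
   Context: Graphs are directed multigraphs $G=(VG,EG,o,t)$. A rooted tree is a graph with a vertex $R$ (the root) such that every vertex has a unique directed path from $R$. For a rooted tree $\mathcal{T}$ with root $R$ and vertex $v$, $\mathcal{T}^v$ is the tree with the same vertices and edges but with the direction of each edge on the path from $R$ to $v$ reversed (a rooted tree with root $v$). $\cong$ is isomorphism of directed graphs. A rooted tree is cocompact if there are a finite set $F$ and $l:V\mathcal{T}\to F$ with $l(v)=l(w)\Rightarrow\mathcal{T}^v\cong\mathcal{T}^w$. Multisets over $X$ have positive integer multiplicities; union adds multiplicities; $M\setminus\{x\}$ removes one copy. $t_m(o^{ -1}(v))$ is the multiset of termini of edges leaving $v$ counted with the number of edges; $l(t_m(o^{ -1}(v)))$ its multiset of labels. Actual labelling of a rooted graph $(G,R)$ with $t^{ -1}(R)=\emptyset$: a finite set $X$, maps $l:VG\to X$, $l_p:VG\setminus\{R\}\to X$, and multisets $M_x$ ($x\in X$) such that for all $v\neq R$: (1) $l_p(v)\in M_{l(v)}$; (2) $l(t_m(o^{ -1}(v)))=M_{l(v)}\setminus\{l_p(v)\}$; (3) $l(o(e))=l_p(v)$ for all edges $e$ with $t(e)=v$; and (4) $l(t_m(o^{ -1}(R)))=M_{l(R)}$. -}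

module Defs where

open import Data.Nat using (ℕ)
open import Data.Fin using (Fin; _≟_)
open import Data.List using (List; []; _∷_; map)
open import Data.List.Membership.Propositional using (_∈_)
open import Data.List.Relation.Unary.Unique.Propositional using (Unique)
open import Data.List.Relation.Binary.Permutation.Propositional using (_↭_)
open import Data.Product using (Σ; ∃; ∃-syntax; _×_; _,_)
open import Data.Sum using (_⊎_)
open import Relation.Nullary using (¬_; yes; no)
open import Relation.Binary.PropositionalEquality using (_≡_)
open import Function.Bundles using (_⇔_; _↔_; Inverse)

record Graph : Set₁ where
  field
    V : Set
    E : Set
    o : E → V
    t : E → V

-- Directed graphs whose origin/terminus are given as relations
-- (used for the re-rooted tree T^v).
record RGraph : Set₁ where
  field
    V : Set
    E : Set
    O : E → V → Set
    T : E → V → Set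

toR : Graph → RGraph
toR G = record { V = V ; E = E ; O = λ e x → o e ≡ x ; T = λ e x → t e ≡ x }
  where open Graph G

record _≅_ (G H : RGraph) : Set where
  private
    module G = RGraph G
    module H = RGraph H
  field
    φ : G.V ↔ H.V
    ψ : G.E ↔ H.E
    pres-O : ∀ e x → G.O e x ⇔ H.O (Inverse.to ψ e) (Inverse.to φ x)
    pres-T : ∀ e x → G.T e x ⇔ H.T (Inverse.to ψ e) (Inverse.to φ x)

module _ (G : Graph) where
  open Graph G

  IsPath : V → List E → V → Set
  IsPath x []       y = x ≡ y
  IsPath x (e ∷ es) y = (o e ≡ x) × IsPath (t e) es y

  IsRootedTree : V → Set
  IsRootedTree R = ∀ v → ∃[ es ] (IsPath R es v × (∀ es′ → IsPath R es′ v → es′ ≡ es))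

  OnPath : V → V → E → Set
  OnPath R v e = ∃[ es ] (IsPath R es v × e ∈ es)

  reroot : V → V → RGraph
  reroot R v = record
    { V = V ; E = E
    ; O = λ e x → (OnPath R v e × x ≡ t e) ⊎ (¬ OnPath R v e × x ≡ o e)
    ; T = λ e x → (OnPath R v e × x ≡ o e) ⊎ (¬ OnPath R v e × x ≡ t e)
    }

-- Multisets over a finite set Fin k as lists up to permutation.

remove : ∀ {k} → Fin k → List (Fin k) → List (Fin k)
remove x [] = []
remove x (y ∷ ys) with x ≟ y
... | yes _ = ys
... | no  _ = y ∷ remove x ys

module _ (G : Graph) where
  open Graph G

  -- l(t_m(o⁻¹(v))) = L : the edges leaving v form a finite list es
  -- (each exactly once), and the multiset of labels of their termini is L.
  OutLabelsAre : ∀ {k} → (V → Fin k) → V → List (Fin k) → Set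
  OutLabelsAre l v L =
    Σ (List E) λ es →
      Unique es × (∀ e → (e ∈ es) ⇔ (o e ≡ v)) × (map (λ e → l (t e)) es ↭ L)

  -- actual labelling of the rooted graph (G , R); labels X = Fin k.
  -- l_p is given as a total map but constrained only on v ≠ R.
  record ActualLabelling (R : V) : Set where
    field
      k   : ℕ
      l   : V → Fin k
      lp  : V → Fin k
      M   : Fin k → List (Fin k)
      noInR : ∀ e → ¬ (t e ≡ R)
      cond1 : ∀ v → ¬ (v ≡ R) → lp v ∈ M (l v)
      cond2 : ∀ v → ¬ (v ≡ R) → OutLabelsAre l v (remove (lp v) (M (l v)))
      cond3 : ∀ v → ¬ (v ≡ R) → ∀ e → t e ≡ v → l (o e) ≡ lp v
      cond4 : OutLabelsAre l R (M (l R))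

  Cocompact : V → Set
  Cocompact R =
    Σ ℕ λ n → Σ (V → Fin n) λ f →
      ∀ v w → f v ≡ f w → reroot G R v ≅ reroot G R w

-- At every vertex v the labels of all neighbours of v, its children together with its
-- parent, form the multiset M (l v); this description does not depend on where the tree
-- is rooted. So in the rerooted tree T^p the children of v carry the labels M (l v) minus
-- the label of the new parent of v, and by induction T^p is isomorphic to the unfolding
-- of M from l p, the tree of child-position sequences whose labels follow that rule.
-- Hence T^p depends on l p only.

module Submission where

open import Defs
open import Data.Bool using (T)
open import Data.Bool.Properties using (T-irrelevant)
open import Data.Empty using (⊥; ⊥-elim)
open import Data.Fin using (Fin) renaming (_≟_ to _≟F_)
open import Data.List using (List; []; _∷_; _++_; _∷ʳ_; [_]; map; filter; last; head; fromMaybe; _ʳ++_)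
open import Data.List.Properties using (++-conicalʳ; ++-identityʳ-unique; ++-identityʳ; ∷-injective; ++-cancelˡ; ++-assoc; ∷ʳ-injectiveʳ; map-++; map-cong-local; partition-defn)
open import Data.List.Membership.Propositional using (_∈_; _∉_)
open import Data.List.Membership.Propositional.Properties using (∈-∃++; ∈-++⁺ˡ; ∈-++⁺ʳ; ∈-++⁻; ∈-filter⁺; ∈-filter⁻)
open import Data.List.Relation.Unary.All as All using (All)
open import Data.List.Relation.Unary.AllPairs using ([]; _∷_)
open import Data.List.Relation.Unary.Any using (here; there)
open import Data.List.Relation.Unary.Unique.Propositional using (Unique)
import Data.List.Relation.Unary.Unique.Propositional.Properties as Unique
open import Data.List.Relation.Binary.Permutation.Propositional using (_↭_; ↭-refl; ↭-sym; ↭-trans; ↭-prep; ↭-swap; ↭-reflexive; ↭ₛ⇒↭; ↭⇒↭ₛ; module PermutationReasoning)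
open import Data.List.Relation.Binary.Permutation.Propositional.Properties using (∈-resp-↭; drop-∷; ∷↭∷ʳ; ↭-map-inv; map⁺; ++⁺ʳ)
import Data.List.Relation.Binary.Permutation.Setoid.Properties as Permutationₛ
open import Data.Maybe using (Maybe; just; nothing; is-just; _>>=_)
import Data.Maybe as Maybe
open import Data.Maybe.Properties using (just-injective)
open import Data.Nat using (ℕ; zero; suc)
import Data.Nat as ℕ
open import Data.Product using (Σ; ∃; ∃-syntax; _×_; _,_; proj₁; proj₂)
open import Data.Sum using (_⊎_; inj₁; inj₂)
import Data.Sum as Sum
open import Data.Unit using (⊤; tt)
open import Function using (_∘_; _⇔_; _↔_; Inverse; Equivalence; mk⇔; mk↔ₛ′)
import Function.Construct.Composition as Compose
import Function.Construct.Symmetry as Symmetry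
open import Relation.Binary.PropositionalEquality using (_≡_; _≢_; refl; sym; trans; cong; cong₂; subst; subst₂; setoid)
open import Relation.Nullary using (¬_; Dec; yes; no; map′)
open import Relation.Nullary.Decidable using (¬?)
open import Relation.Binary.Definitions using (DecidableEquality)

private variable
  A B : Set

_‼_ : List A → ℕ → Maybe A
[]       ‼ _     = nothing
(x ∷ xs) ‼ zero  = just x
(x ∷ xs) ‼ suc i = xs ‼ i

position : {x : A} {xs : List A} → x ∈ xs → ℕ
position (here _)  = zero
position (there m) = suc (position m)

‼-position : {x : A} {xs : List A} (m : x ∈ xs) → xs ‼ position m ≡ just x
‼-position (here refl) = refl
‼-position (there m)   = ‼-position m

‼⇒∈ : {x : A} (xs : List A) (i : ℕ) → xs ‼ i ≡ just x → x ∈ xs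
‼⇒∈ (y ∷ xs) zero    refl = here refl
‼⇒∈ (y ∷ xs) (suc i) eq   = there (‼⇒∈ xs i eq)

‼-injective : {x : A} {xs : List A} → Unique xs → ∀ i j → xs ‼ i ≡ just x → xs ‼ j ≡ just x → i ≡ j
‼-injective (_ ∷ _)               zero    zero    _    _    = refl
‼-injective {xs = _ ∷ xs} (y∉ ∷ _) zero    (suc j) refl xⱼ   = ⊥-elim (All.lookup y∉ (‼⇒∈ xs j xⱼ) refl)
‼-injective {xs = _ ∷ xs} (y∉ ∷ _) (suc i) zero    xᵢ   refl = ⊥-elim (All.lookup y∉ (‼⇒∈ xs i xᵢ) refl)
‼-injective (_ ∷ u)               (suc i) (suc j) xᵢ   xⱼ   = cong suc (‼-injective u i j xᵢ xⱼ)

‼-map : (f : A → B) (xs : List A) (i : ℕ) → map f xs ‼ i ≡ Maybe.map f (xs ‼ i)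
‼-map f []       i       = refl
‼-map f (x ∷ xs) zero    = refl
‼-map f (x ∷ xs) (suc i) = ‼-map f xs i

map-just⁻ : (f : A → B) (m : Maybe A) {y : B} → Maybe.map f m ≡ just y → ∃[ x ] m ≡ just x × f x ≡ y
map-just⁻ f (just x) refl = x , refl , refl

>>=-just⁻ : (m : Maybe A) (f : A → Maybe B) {y : B} → (m >>= f) ≡ just y → ∃[ x ] m ≡ just x × f x ≡ just y
>>=-just⁻ (just x) f eq = x , refl , eq

last-∷ʳ : (xs : List A) (x : A) → last (xs ∷ʳ x) ≡ just x
last-∷ʳ []           x = refl
last-∷ʳ (_ ∷ [])     x = refl
last-∷ʳ (_ ∷ y ∷ xs) x = last-∷ʳ (y ∷ xs) x

∷≢[] : {x : A} {xs : List A} → x ∷ xs ≢ []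
∷≢[] ()

last-nothing : (xs : List A) → last xs ≡ nothing → xs ≡ []
last-nothing []           _  = refl
last-nothing (_ ∷ y ∷ xs) eq with () ← last-nothing (y ∷ xs) eq

fromMaybe-unique : (m : Maybe A) → Unique (fromMaybe m)
fromMaybe-unique nothing  = []
fromMaybe-unique (just x) = All.[] ∷ []

≡[_]-unique : (x : A) {xs : List A} → Unique xs → (∀ y → y ∈ xs ⇔ y ≡ x) → xs ≡ [ x ]
≡[ x ]-unique {[]}         _              ∈⇔ with () ← Equivalence.from (∈⇔ x) refl
≡[ x ]-unique {y ∷ []}     _              ∈⇔ = cong [_] (Equivalence.to (∈⇔ y) (here refl))
≡[ x ]-unique {y ∷ z ∷ xs} ((y≢z All.∷ _) ∷ _) ∈⇔ =
  ⊥-elim (y≢z (trans (Equivalence.to (∈⇔ y) (here refl)) (sym (Equivalence.to (∈⇔ z) (there (here refl))))))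

≡[]-empty : {xs : List A} → (∀ y → y ∉ xs) → xs ≡ []
≡[]-empty {xs = []}     _  = refl
≡[]-empty {xs = x ∷ xs} ∉ = ⊥-elim (∉ x (here refl))

Diverge : List A → List A → Set
Diverge (x ∷ _) (y ∷ _) = x ≢ y
Diverge _       _       = ⊤

¬Diverge-++ : (zs : List A) {x : A} {xs ys : List A} → ¬ Diverge (zs ++ x ∷ xs) (zs ++ x ∷ ys)
¬Diverge-++ []      d = d refl
¬Diverge-++ (_ ∷ _) d = d refl

record CommonPrefix (xs ys : List A) : Set where
  field
    prefix restˡ restʳ : List A
    xs≡ : xs ≡ prefix ++ restˡ
    ys≡ : ys ≡ prefix ++ restʳ
    diverge : Diverge restˡ restʳ

commonPrefix : DecidableEquality A → (xs ys : List A) → CommonPrefix xs ys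
commonPrefix _≟_ (x ∷ xs) (y ∷ ys) with x ≟ y
... | no x≢y  = record { prefix = [] ; xs≡ = refl ; ys≡ = refl ; diverge = x≢y }
... | yes refl = record { prefix = x ∷ prefix ; xs≡ = cong (x ∷_) xs≡ ; ys≡ = cong (x ∷_) ys≡ ; diverge = diverge }
  where open CommonPrefix (commonPrefix _≟_ xs ys)
commonPrefix _≟_ []       ys       = record { prefix = [] ; xs≡ = refl ; ys≡ = refl ; diverge = tt }
commonPrefix _≟_ (x ∷ xs) []       = record { prefix = [] ; xs≡ = refl ; ys≡ = refl ; diverge = tt }

Unique-resp-↭ : {xs ys : List A} → xs ↭ ys → Unique xs → Unique ys
Unique-resp-↭ p = Permutationₛ.Unique-resp-↭ (setoid _) (↭⇒↭ₛ p)

filter-partition-↭ : {P : A → Set} (P? : ∀ x → Dec (P x)) (xs : List A) →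
  xs ↭ filter P? xs ++ filter (λ x → ¬? (P? x)) xs
filter-partition-↭ P? xs =
  subst (λ (ys , zs) → xs ↭ ys ++ zs) (partition-defn P? xs)
    (↭ₛ⇒↭ (Permutationₛ.partition-↭ (setoid _) P? xs))

module _ {k : ℕ} {x : Fin k} where

  remove-↭ : {xs : List (Fin k)} → x ∈ xs → xs ↭ x ∷ remove x xs
  remove-↭ {y ∷ ys} x∈ with x ≟F y
  ... | yes refl = ↭-refl
  remove-↭ {y ∷ ys} (here x≡y) | no x≢y = ⊥-elim (x≢y x≡y)
  remove-↭ {y ∷ ys} (there x∈) | no _   =
    ↭-trans (↭-prep y (remove-↭ x∈)) (↭-swap y x ↭-refl)

  ∷ʳ-↭⇒↭-remove : {xs ys : List (Fin k)} → xs ∷ʳ x ↭ ys → xs ↭ remove x ys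
  ∷ʳ-↭⇒↭-remove {xs} {ys} p = drop-∷ (↭-trans (∷↭∷ʳ x xs) (↭-trans p (remove-↭ x∈ys)))
    where x∈ys = ∈-resp-↭ p (∈-++⁺ʳ xs (here refl))

  ↭-remove⇒∷ʳ-↭ : {xs ys : List (Fin k)} → x ∈ ys → xs ↭ remove x ys → xs ∷ʳ x ↭ ys
  ↭-remove⇒∷ʳ-↭ {xs} x∈ys p = ↭-trans (↭-sym (∷↭∷ʳ x xs)) (↭-trans (↭-prep x p) (↭-sym (remove-↭ x∈ys)))

≅-trans : {G H K : RGraph} → G ≅ H → H ≅ K → G ≅ K
≅-trans i j = record
  { φ      = Compose.inverse (φ i) (φ j)
  ; ψ      = Compose.inverse (ψ i) (ψ j)
  ; pres-O = λ e x → Compose.equivalence (pres-O i e x) (pres-O j _ _)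
  ; pres-T = λ e x → Compose.equivalence (pres-T i e x) (pres-T j _ _)
  }
  where open _≅_

⇔-inverse : {V V′ E E′ : Set} (φ : V ↔ V′) (ψ : E ↔ E′) {RG : E → V → Set} {RH : E′ → V′ → Set} →
  (∀ e x → RG e x ⇔ RH (Inverse.to ψ e) (Inverse.to φ x)) →
  ∀ e x → RH e x ⇔ RG (Inverse.from ψ e) (Inverse.from φ x)
⇔-inverse φ ψ {RH = RH} pres e x = mk⇔
  (λ h → Equivalence.from (pres _ _) (subst₂ RH (sym (ψ.strictlyInverseˡ e)) (sym (φ.strictlyInverseˡ x)) h))
  (λ h → subst₂ RH (ψ.strictlyInverseˡ e) (φ.strictlyInverseˡ x) (Equivalence.to (pres _ _) h))
  where module φ = Inverse φ
        module ψ = Inverse ψ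

≅-sym : {G H : RGraph} → G ≅ H → H ≅ G
≅-sym i = record
  { φ      = Symmetry.inverse φ
  ; ψ      = Symmetry.inverse ψ
  ; pres-O = ⇔-inverse φ ψ pres-O
  ; pres-T = ⇔-inverse φ ψ pres-T
  }
  where open _≅_ i

module _ {V E : Set} (src tgt : E → V) (root : V) where

  RootPath : V → List E → Set
  RootPath v []       = v ≡ root
  RootPath v (e ∷ es) = tgt e ≡ v × RootPath (src e) es

  rootPath-unique : (∀ e → tgt e ≢ root) → (∀ e e′ → tgt e ≡ tgt e′ → e ≡ e′) →
    ∀ {v} es es′ → RootPath v es → RootPath v es′ → es ≡ es′
  rootPath-unique _     _   []       []         _         _           = refl
  rootPath-unique ≢root _   []       (e′ ∷ _)   refl      (e′↦ , _)   = ⊥-elim (≢root e′ e′↦)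
  rootPath-unique ≢root _   (e ∷ _)  []         (e↦ , _)  refl        = ⊥-elim (≢root e e↦)
  rootPath-unique ≢root inj (e ∷ es) (e′ ∷ es′) (e↦ , p)  (e′↦ , p′)
    with inj e e′ (trans e↦ (sym e′↦))
  ... | refl = cong (e ∷_) (rootPath-unique ≢root inj es es′ p p′)

-- The unfolding of M: the tree in which a vertex labelled b whose parent is
-- labelled c (or which is the root, c = nothing) has children labelled by M b ∖ {c}

module Unfolding {k : ℕ} (M : Fin k → List (Fin k)) where

  children : Fin k → Maybe (Fin k) → List (Fin k)
  children b nothing  = M b
  children b (just c) = remove c (M b)

  ↭-children : {xs : List (Fin k)} (b : Fin k) (c : Maybe (Fin k)) → xs ++ fromMaybe c ↭ M b → xs ↭ children b c
  ↭-children {xs} b nothing  p = subst (_↭ M b) (++-identityʳ xs) p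
  ↭-children      b (just c) p = ∷ʳ-↭⇒↭-remove p

  -- An address i ∷ is denotes the i-th child of the vertex at address is;
  -- labelAt returns its label and the label of its parent.
  labelAt : Fin k → List ℕ → Maybe (Fin k × Maybe (Fin k))
  labelAt a []       = just (a , nothing)
  labelAt a (i ∷ is) = labelAt a is >>= λ { (b , c) → Maybe.map (_, just b) (children b c ‼ i) }

  IsVertex : Fin k → List ℕ → Set
  IsVertex a is = T (is-just (labelAt a is))

  isVertex-parent : ∀ {a} i is → IsVertex a (i ∷ is) → IsVertex a is
  isVertex-parent {a} i is h with labelAt a is
  ... | just _ = tt

  Vertex : Fin k → Set
  Vertex a = Σ (List ℕ) (IsVertex a)

  Edge : Fin k → Set
  Edge a = Σ ℕ λ i → Σ (List ℕ) λ is → IsVertex a (i ∷ is)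

  unfold : Fin k → RGraph
  unfold a = record
    { V = Vertex a
    ; E = Edge a
    ; O = λ (i , is , h) x → (is , isVertex-parent i is h) ≡ x
    ; T = λ (i , is , h) x → (i ∷ is , h) ≡ x
    }

  vertex-≡ : ∀ {a is is′} {h : IsVertex a is} {h′ : IsVertex a is′} →
    is ≡ is′ → _≡_ {A = Vertex a} (is , h) (is′ , h′)
  vertex-≡ {h = h} {h′} refl = cong (_ ,_) (T-irrelevant h h′)

  edge-≡ : ∀ {a i i′ is is′} {h : IsVertex a (i ∷ is)} {h′ : IsVertex a (i′ ∷ is′)} →
    i ≡ i′ → is ≡ is′ → _≡_ {A = Edge a} (i , is , h) (i′ , is′ , h′)
  edge-≡ {h = h} {h′} refl refl = cong (λ h → _ , _ , h) (T-irrelevant h h′)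

  record LabelledTree : Set₁ where
    field
      graph : RGraph
    open RGraph graph using (V; E; O)
    field
      src tgt       : E → V
      O⇔src         : ∀ e x → O e x ⇔ (src e ≡ x)
      T⇔tgt         : ∀ e x → RGraph.T graph e x ⇔ (tgt e ≡ x)
      root          : V
      tgt≢root      : ∀ e → tgt e ≢ root
      tgt-injective : ∀ e e′ → tgt e ≡ tgt e′ → e ≡ e′
      rootPath      : ∀ v → ∃ (RootPath src tgt root v)
      label         : V → Fin k
      parentLabel   : V → Maybe (Fin k)
      parentLabel-root  : parentLabel root ≡ nothing
      parentLabel-tgt   : ∀ e → parentLabel (tgt e) ≡ just (label (src e))
      childEdges        : V → List E
      childEdges-unique : ∀ v → Unique (childEdges v)
      ∈childEdges⇔      : ∀ v e → e ∈ childEdges v ⇔ src e ≡ v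
      childEdges-labels : ∀ v → map (label ∘ tgt) (childEdges v) ≡ children (label v) (parentLabel v)

  -- A vertex corresponds to the sequence of child positions leading to it from the root.
  module _ (S : LabelledTree) where
    open LabelledTree S
    open RGraph graph using (V; E)

    ∈childEdges : ∀ e → e ∈ childEdges (src e)
    ∈childEdges e = Equivalence.from (∈childEdges⇔ (src e) e) refl

    childPosition : E → ℕ
    childPosition e = position (∈childEdges e)

    follow : List ℕ → Maybe V
    follow []       = just root
    follow (i ∷ is) = follow is >>= λ u → Maybe.map tgt (childEdges u ‼ i)

    labelAt-child : ∀ u i →
      Maybe.map (_, just (label u)) (children (label u) (parentLabel u) ‼ i) ≡
      Maybe.map (λ v → label v , parentLabel v) (Maybe.map tgt (childEdges u ‼ i))
    labelAt-child u i rewrite sym (childEdges-labels u) | ‼-map (label ∘ tgt) (childEdges u) i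
      with childEdges u ‼ i in eq
    ... | nothing = refl
    ... | just e  = cong (λ c → just (label (tgt e) , c)) (sym (trans (parentLabel-tgt e) (cong (just ∘ label) src≡u)))
      where src≡u = Equivalence.to (∈childEdges⇔ u e) (‼⇒∈ (childEdges u) i eq)

    labelAt-follow : ∀ is → labelAt (label root) is ≡ Maybe.map (λ v → label v , parentLabel v) (follow is)
    labelAt-follow []       = cong (λ c → just (label root , c)) (sym parentLabel-root)
    labelAt-follow (i ∷ is) with follow is | labelAt-follow is
    ... | nothing | eq rewrite eq = refl
    ... | just u  | eq rewrite eq = labelAt-child u i

    follow-rootPath : ∀ {v} es → RootPath src tgt root v es → follow (map childPosition es) ≡ just v
    follow-rootPath []       refl           = refl
    follow-rootPath (e ∷ es) (refl , path) rewrite follow-rootPath es path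
      | ‼-position (∈childEdges e) = refl

    follow⇒rootPath : ∀ is {u} → follow is ≡ just u → ∃[ es ] RootPath src tgt root u es × map childPosition es ≡ is
    follow⇒rootPath []       refl = [] , refl , refl
    follow⇒rootPath (i ∷ is) eq
      with w , w≡ , eq′ ← >>=-just⁻ (follow is) _ eq
      with e , eᵢ , refl ← map-just⁻ tgt (childEdges w ‼ i) eq′
      with refl ← Equivalence.to (∈childEdges⇔ w e) (‼⇒∈ (childEdges w) i eᵢ)
      with es , path , es↦is ← follow⇒rootPath is w≡
      = e ∷ es , (refl , path) , cong₂ _∷_ i≡ es↦is
      where i≡ = ‼-injective (childEdges-unique (src e)) _ _ (‼-position (∈childEdges e)) eᵢ

    address : V → List ℕ
    address v = map childPosition (proj₁ (rootPath v))

    follow-address : ∀ v → follow (address v) ≡ just v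
    follow-address v = follow-rootPath _ (proj₂ (rootPath v))

    address-follow : ∀ is {u} → follow is ≡ just u → address u ≡ is
    address-follow is eq with es , path , es↦is ← follow⇒rootPath is eq =
      trans (cong (map childPosition) (rootPath-unique src tgt root tgt≢root tgt-injective _ es (proj₂ (rootPath _)) path)) es↦is

    address-injective : ∀ v w → address v ≡ address w → v ≡ w
    address-injective v w eq = just-injective (trans (sym (follow-address v)) (trans (cong follow eq) (follow-address w)))

    address-tgt : ∀ e → address (tgt e) ≡ childPosition e ∷ address (src e)
    address-tgt e = address-follow (childPosition e ∷ address (src e)) eq
      where eq : follow (childPosition e ∷ address (src e)) ≡ just (tgt e)
            eq rewrite follow-address (src e) | ‼-position (∈childEdges e) = refl

    isVertex-address : ∀ v → IsVertex (label root) (address v)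
    isVertex-address v = subst (T ∘ is-just) (sym (trans (labelAt-follow (address v)) (cong (Maybe.map _) (follow-address v)))) tt

    vertexAt : ∀ is → IsVertex (label root) is → ∃[ u ] follow is ≡ just u
    vertexAt is h with follow is | labelAt-follow is
    ... | just u  | _  = u , refl
    ... | nothing | eq = ⊥-elim (subst (T ∘ is-just) eq h)

    childAt : ∀ i is → IsVertex (label root) (i ∷ is) →
      ∃[ e ] follow is ≡ just (src e) × childEdges (src e) ‼ i ≡ just e
    childAt i is h
      with u , eq ← vertexAt (i ∷ is) h
      with w , w≡ , eq′ ← >>=-just⁻ (follow is) _ eq
      with e , eᵢ , _ ← map-just⁻ tgt (childEdges w ‼ i) eq′
      with refl ← Equivalence.to (∈childEdges⇔ w e) (‼⇒∈ (childEdges w) i eᵢ)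
      = e , w≡ , eᵢ

    toVertex : V → Vertex (label root)
    toVertex v = address v , isVertex-address v

    fromVertex : Vertex (label root) → V
    fromVertex (is , h) = proj₁ (vertexAt is h)

    toEdge : E → Edge (label root)
    toEdge e = childPosition e , address (src e) , subst (IsVertex _) (address-tgt e) (isVertex-address (tgt e))

    fromEdge : Edge (label root) → E
    fromEdge (i , is , h) = proj₁ (childAt i is h)

    fromEdge-toEdge : ∀ e → fromEdge (toEdge e) ≡ e
    fromEdge-toEdge e = just-injective
      (trans (sym e′-at) (trans (cong (λ w → childEdges w ‼ childPosition e) src≡) (‼-position (∈childEdges e))))
      where
      e′-src = proj₁ (proj₂ (childAt _ _ (proj₂ (proj₂ (toEdge e)))))
      e′-at  = proj₂ (proj₂ (childAt _ _ (proj₂ (proj₂ (toEdge e)))))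
      src≡   = just-injective (trans (sym e′-src) (follow-address (src e)))

    toEdge-fromEdge : ∀ y → toEdge (fromEdge y) ≡ y
    toEdge-fromEdge (i , is , h) =
      edge-≡ (‼-injective (childEdges-unique _) _ _ (‼-position (∈childEdges (fromEdge (i , is , h)))) e-at)
             (address-follow is e-src)
      where
      e-src = proj₁ (proj₂ (childAt i is h))
      e-at  = proj₂ (proj₂ (childAt i is h))

    labelledTree≅unfold : graph ≅ unfold (label root)
    labelledTree≅unfold = record
      { φ      = mk↔ₛ′ toVertex fromVertex
                   (λ (is , h) → vertex-≡ (address-follow is (proj₂ (vertexAt is h))))
                   (λ v → just-injective (trans (sym (proj₂ (vertexAt (address v) (isVertex-address v)))) (follow-address v)))
      ; ψ      = mk↔ₛ′ toEdge fromEdge toEdge-fromEdge fromEdge-toEdge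
      ; pres-O = λ e x → Compose.equivalence (O⇔src e x)
                   (mk⇔ (λ eq → vertex-≡ (cong address eq)) (λ eq → address-injective _ _ (cong proj₁ eq)))
      ; pres-T = λ e x → Compose.equivalence (T⇔tgt e x)
                   (mk⇔ (λ eq → vertex-≡ (trans (sym (address-tgt e)) (cong address eq)))
                        (λ eq → address-injective _ _ (trans (address-tgt e) (cong proj₁ eq))))
      }

module Paths (G : Graph) where
  open Graph G

  path-++⁻ : ∀ {x y} xs {ys} → IsPath G x (xs ++ ys) y → ∃[ m ] IsPath G x xs m × IsPath G m ys y
  path-++⁻ []       path           = _ , refl , path
  path-++⁻ (e ∷ xs) (o≡ , path) with m , p , q ← path-++⁻ xs path = m , (o≡ , p) , q

  path-++⁺ : ∀ {x m y} xs {ys} → IsPath G x xs m → IsPath G m ys y → IsPath G x (xs ++ ys) y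
  path-++⁺ []       refl        q = q
  path-++⁺ (e ∷ xs) (o≡ , p) q = o≡ , path-++⁺ xs p q

  path-target-unique : ∀ {x y y′} es → IsPath G x es y → IsPath G x es y′ → y ≡ y′
  path-target-unique []       refl   refl   = refl
  path-target-unique (e ∷ es) (_ , p) (_ , q) = path-target-unique es p q

  path-last : ∀ {x y e} xs → IsPath G x xs y → last xs ≡ just e → t e ≡ y
  path-last (_ ∷ [])     (_ , refl) refl = refl
  path-last (_ ∷ x ∷ xs) (_ , path) eq   = path-last (x ∷ xs) path eq

module RootedTree (G : Graph) (R : Graph.V G) (tree : IsRootedTree G R) where
  open Graph G
  open Paths G

  π : V → List E
  π v = proj₁ (tree v)

  π-path : ∀ v → IsPath G R (π v) v
  π-path v = proj₁ (proj₂ (tree v))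

  π-unique : ∀ {v} es → IsPath G R es v → es ≡ π v
  π-unique es path = proj₂ (proj₂ (tree _)) es path

  π-injective : ∀ {v w} → π v ≡ π w → v ≡ w
  π-injective {v} {w} eq = path-target-unique (π v) (π-path v) (subst (λ es → IsPath G R es w) (sym eq) (π-path w))

  π-root : π R ≡ []
  π-root = sym (π-unique [] refl)

  π-t : ∀ e → π (t e) ≡ π (o e) ∷ʳ e
  π-t e = sym (π-unique _ (path-++⁺ (π (o e)) (π-path (o e)) (refl , refl)))

  t-injective : ∀ e e′ → t e ≡ t e′ → e ≡ e′
  t-injective e e′ eq = ∷ʳ-injectiveʳ (π (o e)) (π (o e′)) (trans (sym (π-t e)) (trans (cong π eq) (π-t e′)))

  t≢R : ∀ e → t e ≢ R
  t≢R e eq = ∷≢[] (++-conicalʳ (π (o e)) [ e ] (trans (sym (π-t e)) (trans (cong π eq) π-root)))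

  o≢t : ∀ e → o e ≢ t e
  o≢t e eq with () ← ++-identityʳ-unique (π (o e)) (trans (cong π eq) (π-t e))

  ≡R? : ∀ v → Dec (v ≡ R)
  ≡R? v with π v in eq
  ... | []    = yes (sym (subst (λ es → IsPath G R es v) eq (π-path v)))
  ... | _ ∷ _ = no (λ v≡R → ∷≢[] (trans (sym eq) (trans (cong π v≡R) π-root)))

  π-prefix : ∀ {v e} xs {ys} → π v ≡ xs ++ e ∷ ys → xs ≡ π (o e)
  π-prefix {v} xs eq with m , path , (o≡ , _) ← path-++⁻ xs (subst (λ es → IsPath G R es v) eq (π-path v)) =
    π-unique xs (subst (IsPath G R xs) (sym o≡) path)

  π-split : ∀ {v e} → e ∈ π v → ∃[ S ] π v ≡ π (o e) ++ e ∷ S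
  π-split e∈ with pre , S , eq ← ∈-∃++ e∈ = S , trans eq (cong (_++ _) (π-prefix pre eq))

  ∈π-t : ∀ e → e ∈ π (t e)
  ∈π-t e = subst (e ∈_) (sym (π-t e)) (∈-++⁺ʳ (π (o e)) (here refl))

  inEdges : V → List E
  inEdges v = fromMaybe (last (π v))

  ∈inEdges⇔ : ∀ {v e} → e ∈ inEdges v ⇔ t e ≡ v
  ∈inEdges⇔ {v} {e} = mk⇔ to from
    where
    to : e ∈ inEdges v → t e ≡ v
    to e∈ with last (π v) in eq
    to (here refl) | just _ = path-last (π v) (π-path v) eq
    from : t e ≡ v → e ∈ inEdges v
    from refl rewrite π-t e | last-∷ʳ (π (o e)) e = here refl

  inEdges-root : inEdges R ≡ []
  inEdges-root = ≡[]-empty (λ e e∈ → t≢R e (Equivalence.to ∈inEdges⇔ e∈))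

  inEdges-nonroot : ∀ {v} → v ≢ R → ∃[ e ] inEdges v ≡ [ e ]
  inEdges-nonroot {v} v≢R with last (π v) in eq
  ... | just e  = e , refl
  ... | nothing = ⊥-elim (v≢R (π-injective (trans (last-nothing (π v) eq) (sym π-root))))

  module LocallyFinite
    (outs : V → List E) (outs-unique : ∀ v → Unique (outs v)) (∈outs⇔ : ∀ v e → e ∈ outs v ⇔ o e ≡ v)
    where

    sibling-≟ : ∀ e e′ → o e ≡ o e′ → Dec (e ≡ e′)
    sibling-≟ e e′ eq = map′
      (λ i≡j → just-injective (trans (sym (‼-position e∈)) (trans (cong (outs (o e) ‼_) i≡j) (‼-position e′∈))))
      (λ { refl → ‼-injective (outs-unique (o e)) _ _ (‼-position e∈) (‼-position e′∈) })
      (position e∈ ℕ.≟ position e′∈)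
      where
      e∈  = Equivalence.from (∈outs⇔ (o e) e) refl
      e′∈ = Equivalence.from (∈outs⇔ (o e) e′) (sym eq)

    paths-≟ : ∀ {x y y′} es es′ → IsPath G x es y → IsPath G x es′ y′ → Dec (es ≡ es′)
    paths-≟ []       []         _         _           = yes refl
    paths-≟ []       (_ ∷ _)    _         _           = no λ ()
    paths-≟ (_ ∷ _)  []         _         _           = no λ ()
    paths-≟ (e ∷ es) (e′ ∷ es′) (o≡ , p)  (o≡′ , p′) with sibling-≟ e e′ (trans o≡ (sym o≡′))
    ... | no e≢e′  = no (e≢e′ ∘ proj₁ ∘ ∷-injective)
    ... | yes refl = map′ (cong (e ∷_)) (proj₂ ∘ ∷-injective) (paths-≟ es es′ p p′)

    _≟V_ : DecidableEquality V
    v ≟V w = map′ π-injective (cong π) (paths-≟ (π v) (π w) (π-path v) (π-path w))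

    _≟E_ : DecidableEquality E
    e ≟E e′ with o e ≟V o e′
    ... | yes o≡ = sibling-≟ e e′ o≡
    ... | no o≢  = no (o≢ ∘ cong o)

    incident : V → List E
    incident v = outs v ++ inEdges v

    ∈incident⇔ : ∀ {v e} → e ∈ incident v ⇔ (o e ≡ v ⊎ t e ≡ v)
    ∈incident⇔ {v} {e} = mk⇔
      (Sum.map (Equivalence.to (∈outs⇔ v e)) (Equivalence.to ∈inEdges⇔) ∘ ∈-++⁻ (outs v))
      Sum.[ ∈-++⁺ˡ ∘ Equivalence.from (∈outs⇔ v e) , ∈-++⁺ʳ (outs v) ∘ Equivalence.from ∈inEdges⇔ ]

    incident-unique : ∀ v → Unique (incident v)
    incident-unique v = Unique.++⁺ (outs-unique v) (fromMaybe-unique _)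
      (λ (e∈outs , e∈in) → o≢t _ (trans (Equivalence.to (∈outs⇔ v _) e∈outs) (sym (Equivalence.to ∈inEdges⇔ e∈in))))

    opposite : V → E → V
    opposite v e with o e ≟V v
    ... | yes _ = t e
    ... | no  _ = o e

    opposite-o : ∀ {v e} → o e ≡ v → opposite v e ≡ t e
    opposite-o {v} {e} o≡v with o e ≟V v
    ... | yes _   = refl
    ... | no o≢v  = ⊥-elim (o≢v o≡v)

    opposite-t : ∀ {v e} → t e ≡ v → opposite v e ≡ o e
    opposite-t {v} {e} t≡v with o e ≟V v
    ... | yes o≡v = ⊥-elim (o≢t e (trans o≡v (sym t≡v)))
    ... | no _    = refl

    module Reroot (p : V) where
      open import Data.List.Membership.DecPropositional _≟E_ using (_∈?_)

      P : List E
      P = π p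

      onPath⇔ : ∀ {e} → OnPath G R p e ⇔ e ∈ P
      onPath⇔ {e} = mk⇔ (λ (es , path , e∈) → subst (e ∈_) (π-unique es path) e∈) (λ e∈ → P , π-path p , e∈)

      pick : E → V → V → V
      pick e a b with e ∈? P
      ... | yes _ = a
      ... | no  _ = b

      pick-on : ∀ {e a b} → e ∈ P → pick e a b ≡ a
      pick-on {e} e∈ with e ∈? P
      ... | yes _  = refl
      ... | no e∉  = ⊥-elim (e∉ e∈)

      pick-off : ∀ {e a b} → e ∉ P → pick e a b ≡ b
      pick-off {e} e∉ with e ∈? P
      ... | yes e∈ = ⊥-elim (e∉ e∈)
      ... | no _   = refl

      pick⇔ : ∀ e a b x → ((OnPath G R p e × x ≡ a) ⊎ (¬ OnPath G R p e × x ≡ b)) ⇔ (pick e a b ≡ x)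
      pick⇔ e a b x with e ∈? P
      ... | yes e∈ = mk⇔ (λ { (inj₁ (_ , refl)) → refl ; (inj₂ (e∉ , _)) → ⊥-elim (e∉ (Equivalence.from onPath⇔ e∈)) })
                         (λ { refl → inj₁ (Equivalence.from onPath⇔ e∈ , refl) })
      ... | no e∉  = mk⇔ (λ { (inj₁ (e∈ , _)) → ⊥-elim (e∉ (Equivalence.to onPath⇔ e∈)) ; (inj₂ (_ , refl)) → refl })
                         (λ { refl → inj₂ (e∉ ∘ Equivalence.to onPath⇔ , refl) })

      o′ t′ : E → V
      o′ e = pick e (t e) (o e)
      t′ e = pick e (o e) (t e)

      endpoints′ : ∀ e → (o′ e ≡ t e × t′ e ≡ o e) ⊎ (o′ e ≡ o e × t′ e ≡ t e)
      endpoints′ e with e ∈? P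
      ... | yes _ = inj₁ (refl , refl)
      ... | no  _ = inj₂ (refl , refl)

      on-o≢p : ∀ {e} → e ∈ P → o e ≢ p
      on-o≢p {e} e∈ o≡p with S , split ← π-split e∈ =
        ∷≢[] (++-identityʳ-unique (π (o e)) (trans (cong π o≡p) split))

      off-t≢p : ∀ {e} → e ∉ P → t e ≢ p
      off-t≢p {e} e∉ t≡p = e∉ (subst (e ∈_) (cong π t≡p) (∈π-t e))

      on-o-injective : ∀ {e e′} → e ∈ P → e′ ∈ P → o e ≡ o e′ → e ≡ e′
      on-o-injective {e} {e′} e∈ e′∈ o≡ with S , split ← π-split e∈ with S′ , split′ ← π-split e′∈ =
        proj₁ (∷-injective (++-cancelˡ (π (o e)) (e ∷ S) (e′ ∷ S′)
          (trans (sym split) (trans split′ (cong (λ v → π v ++ e′ ∷ S′) (sym o≡))))))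

      on-o≢off-t : ∀ {e e′} → e ∈ P → e′ ∉ P → o e ≢ t e′
      on-o≢off-t {e} {e′} e∈ e′∉ o≡t with S , split ← π-split e∈ =
        e′∉ (subst (e′ ∈_) (sym split) (∈-++⁺ˡ (subst (e′ ∈_) (cong π (sym o≡t)) (∈π-t e′))))

      t′≢p : ∀ e → t′ e ≢ p
      t′≢p e with e ∈? P
      ... | yes e∈ = on-o≢p e∈
      ... | no e∉  = off-t≢p e∉

      t′-injective : ∀ e e′ → t′ e ≡ t′ e′ → e ≡ e′
      t′-injective e e′ with e ∈? P | e′ ∈? P
      ... | yes e∈ | yes e′∈ = on-o-injective e∈ e′∈
      ... | yes e∈ | no e′∉  = ⊥-elim ∘ on-o≢off-t e∈ e′∉
      ... | no e∉  | yes e′∈ = ⊥-elim ∘ on-o≢off-t e′∈ e∉ ∘ sym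
      ... | no _   | no _    = t-injective e e′

      RootPath′ : V → List E → Set
      RootPath′ = RootPath o′ t′ p

      upPath : ∀ {m} β → IsPath G m β p → All (_∈ P) β → RootPath′ m β
      upPath []      path        _              = path
      upPath (b ∷ β) (o≡ , path) (b∈ All.∷ β∈) =
        trans (pick-on b∈) o≡ , subst (λ x → RootPath′ x β) (sym (pick-on b∈)) (upPath β path β∈)

      downPath : ∀ {x v acc} γ → IsPath G x γ v → All (_∉ P) γ → RootPath′ x acc → RootPath′ v (γ ʳ++ acc)
      downPath []      refl        _              back = back
      downPath (e ∷ γ) (o≡ , path) (e∉ All.∷ γ∉) back =
        downPath γ path γ∉ (pick-off e∉ , subst (λ x → RootPath′ x _) (sym (trans (pick-off e∉) o≡)) back)

      offPath-beyond : ∀ {v α γ β} → π v ≡ α ++ γ → P ≡ α ++ β → Diverge γ β → All (_∉ P) γ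
      offPath-beyond {v} {α} {γ} {β} v≡ p≡ d = All.tabulate γ∉
        where
        γ∉ : ∀ {e} → e ∈ γ → e ∉ P
        γ∉ {e} e∈γ e∈P with g , S , refl ← ∈-∃++ e∈γ with S′ , split ← π-split e∈P =
          ¬Diverge-++ g (subst (Diverge (g ++ e ∷ S)) β≡ d)
          where
          αg≡ : α ++ g ≡ π (o e)
          αg≡ = π-prefix (α ++ g) (trans v≡ (sym (++-assoc α g (e ∷ S))))
          β≡ : β ≡ g ++ e ∷ S′
          β≡ = ++-cancelˡ α β (g ++ e ∷ S′)
                 (trans (sym p≡) (trans split (trans (cong (_++ e ∷ S′) (sym αg≡)) (++-assoc α g (e ∷ S′)))))

      -- Back from v along γ to the branch point of v and p, then along β down to p.
      rootPath′ : ∀ v → ∃ (RootPath′ v)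
      rootPath′ v = γ ʳ++ β , downPath γ γ-path (offPath-beyond xs≡ ys≡ diverge)
                                (subst (λ x → RootPath′ x β) (sym m≡) (upPath β β-path β-on))
        where
        open CommonPrefix (commonPrefix _≟E_ (π v) P) renaming (prefix to α; restˡ to γ; restʳ to β)
        v-split = path-++⁻ α (subst (λ es → IsPath G R es v) xs≡ (π-path v))
        p-split = path-++⁻ α (subst (λ es → IsPath G R es p) ys≡ (π-path p))
        γ-path = proj₂ (proj₂ v-split)
        β-path = proj₂ (proj₂ p-split)
        m≡ : proj₁ v-split ≡ proj₁ p-split
        m≡ = path-target-unique α (proj₁ (proj₂ v-split)) (proj₁ (proj₂ p-split))
        β-on : All (_∈ P) β
        β-on = All.tabulate (λ e∈β → subst (_ ∈_) (sym ys≡) (∈-++⁺ʳ α e∈β))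

      rootPath′-unique : ∀ {v} es es′ → RootPath′ v es → RootPath′ v es′ → es ≡ es′
      rootPath′-unique = rootPath-unique o′ t′ p t′≢p t′-injective

      o′≢t′ : ∀ e → o′ e ≢ t′ e
      o′≢t′ e with endpoints′ e
      ... | inj₁ (o′≡ , t′≡) = λ eq → o≢t e (trans (sym t′≡) (trans (sym eq) o′≡))
      ... | inj₂ (o′≡ , t′≡) = λ eq → o≢t e (trans (sym o′≡) (trans eq t′≡))

      incident-o′ : ∀ e → e ∈ incident (o′ e)
      incident-o′ e with endpoints′ e
      ... | inj₁ (o′≡ , _) = Equivalence.from ∈incident⇔ (inj₂ (sym o′≡))
      ... | inj₂ (o′≡ , _) = Equivalence.from ∈incident⇔ (inj₁ (sym o′≡))

      incident-t′ : ∀ e → e ∈ incident (t′ e)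
      incident-t′ e with endpoints′ e
      ... | inj₁ (_ , t′≡) = Equivalence.from ∈incident⇔ (inj₁ (sym t′≡))
      ... | inj₂ (_ , t′≡) = Equivalence.from ∈incident⇔ (inj₂ (sym t′≡))

      incident-t′≡ : ∀ {v e} → e ∈ incident v → o′ e ≢ v → t′ e ≡ v
      incident-t′≡ {v} {e} e∈ o′≢v with endpoints′ e | Equivalence.to ∈incident⇔ e∈
      ... | inj₁ (_ , t′≡)  | inj₁ o≡v = trans t′≡ o≡v
      ... | inj₁ (o′≡ , _)  | inj₂ t≡v = ⊥-elim (o′≢v (trans o′≡ t≡v))
      ... | inj₂ (o′≡ , _)  | inj₁ o≡v = ⊥-elim (o′≢v (trans o′≡ o≡v))
      ... | inj₂ (_ , t′≡)  | inj₂ t≡v = trans t′≡ t≡v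

      opposite-o′ : ∀ {v e} → o′ e ≡ v → opposite v e ≡ t′ e
      opposite-o′ {e = e} o′≡v with endpoints′ e
      ... | inj₁ (o′≡ , t′≡) = trans (opposite-t (trans (sym o′≡) o′≡v)) (sym t′≡)
      ... | inj₂ (o′≡ , t′≡) = trans (opposite-o (trans (sym o′≡) o′≡v)) (sym t′≡)

      opposite-t′ : ∀ {v e} → t′ e ≡ v → opposite v e ≡ o′ e
      opposite-t′ {e = e} t′≡v with endpoints′ e
      ... | inj₁ (o′≡ , t′≡) = trans (opposite-o (trans (sym t′≡) t′≡v)) (sym o′≡)
      ... | inj₂ (o′≡ , t′≡) = trans (opposite-t (trans (sym t′≡) t′≡v)) (sym o′≡)

      childEdges′ parentEdges′ : V → List E
      childEdges′  v = filter (λ e → o′ e ≟V v) (incident v)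
      parentEdges′ v = filter (λ e → ¬? (o′ e ≟V v)) (incident v)

      ∈childEdges′⇔ : ∀ v e → e ∈ childEdges′ v ⇔ o′ e ≡ v
      ∈childEdges′⇔ v e = mk⇔ (proj₂ ∘ ∈-filter⁻ (λ e → o′ e ≟V v) {xs = incident v})
                              (λ o′≡v → ∈-filter⁺ (λ e → o′ e ≟V v) (subst (λ x → e ∈ incident x) o′≡v (incident-o′ e)) o′≡v)

      ∈parentEdges′⇔ : ∀ v e → e ∈ parentEdges′ v ⇔ t′ e ≡ v
      ∈parentEdges′⇔ v e = mk⇔
        (λ e∈ → let (e∈inc , o′≢v) = ∈-filter⁻ (λ e → ¬? (o′ e ≟V v)) {xs = incident v} e∈ in incident-t′≡ e∈inc o′≢v)
        (λ t′≡v → ∈-filter⁺ (λ e → ¬? (o′ e ≟V v)) (subst (λ x → e ∈ incident x) t′≡v (incident-t′ e))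
                    (λ o′≡v → o′≢t′ e (trans o′≡v (sym t′≡v))))

module Labelled (G : Graph) (R : Graph.V G) (tree : IsRootedTree G R) (L : ActualLabelling G R) where
  open Graph G
  open ActualLabelling L
  open RootedTree G R tree
  open Unfolding M

  outLabels : V → List (Fin k)
  outLabels v with ≡R? v
  ... | yes _ = M (l v)
  ... | no  _ = remove (lp v) (M (l v))

  outLabelling : ∀ v → OutLabelsAre G l v (outLabels v)
  outLabelling v with ≡R? v
  ... | yes refl = cond4
  ... | no v≢R   = cond2 v v≢R

  inLabels-nonroot : ∀ {v} → v ≢ R → map (l ∘ o) (inEdges v) ≡ [ lp v ]
  inLabels-nonroot {v} v≢R with e , eq ← inEdges-nonroot v≢R =
    trans (cong (map (l ∘ o)) eq) (cong [_] (cond3 v v≢R e (Equivalence.to ∈inEdges⇔ (subst (e ∈_) (sym eq) (here refl)))))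

  outLabels-++ : ∀ v → outLabels v ++ map (l ∘ o) (inEdges v) ↭ M (l v)
  outLabels-++ v with ≡R? v
  ... | yes refl = subst (λ es → M (l R) ++ map (l ∘ o) es ↭ M (l R)) (sym inEdges-root) (↭-reflexive (++-identityʳ _))
  ... | no v≢R   = subst (λ ls → remove (lp v) (M (l v)) ++ ls ↭ M (l v)) (sym (inLabels-nonroot v≢R))
                     (↭-remove⇒∷ʳ-↭ (cond1 v v≢R) ↭-refl)

  outs : V → List E
  outs v = proj₁ (outLabelling v)

  outs-unique : ∀ v → Unique (outs v)
  outs-unique v = proj₁ (proj₂ (outLabelling v))

  ∈outs⇔ : ∀ v e → e ∈ outs v ⇔ o e ≡ v
  ∈outs⇔ v = proj₁ (proj₂ (proj₂ (outLabelling v)))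

  outs-labels : ∀ v → map (l ∘ t) (outs v) ↭ outLabels v
  outs-labels v = proj₂ (proj₂ (proj₂ (outLabelling v)))

  open LocallyFinite outs outs-unique ∈outs⇔

  neighbourLabels : ∀ v → map (l ∘ opposite v) (incident v) ↭ M (l v)
  neighbourLabels v = begin
    map (l ∘ opposite v) (outs v ++ inEdges v)                        ≡⟨ map-++ _ (outs v) (inEdges v) ⟩
    map (l ∘ opposite v) (outs v) ++ map (l ∘ opposite v) (inEdges v) ≡⟨ cong₂ _++_ outs-opposite inEdges-opposite ⟩
    map (l ∘ t) (outs v) ++ map (l ∘ o) (inEdges v)                   ↭⟨ ++⁺ʳ _ (outs-labels v) ⟩
    outLabels v ++ map (l ∘ o) (inEdges v)                            ↭⟨ outLabels-++ v ⟩
    M (l v)                                                           ∎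
    where
    open PermutationReasoning
    outs-opposite : map (l ∘ opposite v) (outs v) ≡ map (l ∘ t) (outs v)
    outs-opposite = map-cong-local (All.tabulate (cong l ∘ opposite-o ∘ Equivalence.to (∈outs⇔ v _)))
    inEdges-opposite : map (l ∘ opposite v) (inEdges v) ≡ map (l ∘ o) (inEdges v)
    inEdges-opposite = map-cong-local (All.tabulate (cong l ∘ opposite-t ∘ Equivalence.to ∈inEdges⇔))

  module _ (p : V) where
    open Reroot p

    parentLabel′ : V → Maybe (Fin k)
    parentLabel′ v = Maybe.map (l ∘ o′) (head (proj₁ (rootPath′ v)))

    parentLabel′-root : parentLabel′ p ≡ nothing
    parentLabel′-root = cong (Maybe.map (l ∘ o′) ∘ head) (rootPath′-unique _ [] (proj₂ (rootPath′ p)) refl)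

    parentLabel′-t′ : ∀ e → parentLabel′ (t′ e) ≡ just (l (o′ e))
    parentLabel′-t′ e = cong (Maybe.map (l ∘ o′) ∘ head)
      (rootPath′-unique _ (e ∷ proj₁ (rootPath′ (o′ e))) (proj₂ (rootPath′ (t′ e))) (refl , proj₂ (rootPath′ (o′ e))))

    parentEdges′-labels : ∀ v → map (l ∘ o′) (parentEdges′ v) ≡ fromMaybe (parentLabel′ v)
    parentEdges′-labels v = fromRootPath (rootPath′ v)
      where
      fromRootPath : ∃ (RootPath′ v) → map (l ∘ o′) (parentEdges′ v) ≡ fromMaybe (parentLabel′ v)
      fromRootPath ([] , v≡p) =
        trans (cong (map (l ∘ o′)) (≡[]-empty λ e e∈ → t′≢p e (trans (Equivalence.to (∈parentEdges′⇔ v e) e∈) v≡p)))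
              (cong fromMaybe (sym (trans (cong parentLabel′ v≡p) parentLabel′-root)))
      fromRootPath (e ∷ _ , t′≡v , _) =
        trans (cong (map (l ∘ o′)) (≡[ e ]-unique (Unique.filter⁺ (λ e → ¬? (o′ e ≟V v)) (incident-unique v)) λ y → mk⇔
                (λ y∈ → t′-injective y e (trans (Equivalence.to (∈parentEdges′⇔ v y) y∈) (sym t′≡v)))
                (λ { refl → Equivalence.from (∈parentEdges′⇔ v e) t′≡v })))
              (cong fromMaybe (sym (trans (cong parentLabel′ (sym t′≡v)) (parentLabel′-t′ e))))

    childEdges′-labels : ∀ v → map (l ∘ t′) (childEdges′ v) ↭ children (l v) (parentLabel′ v)
    childEdges′-labels v = ↭-children (l v) (parentLabel′ v) (begin
      map (l ∘ t′) (childEdges′ v) ++ fromMaybe (parentLabel′ v)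
        ≡⟨ cong₂ _++_ children-opposite (trans (sym (parentEdges′-labels v)) parents-opposite) ⟩
      map (l ∘ opposite v) (childEdges′ v) ++ map (l ∘ opposite v) (parentEdges′ v)
        ≡⟨ sym (map-++ _ (childEdges′ v) (parentEdges′ v)) ⟩
      map (l ∘ opposite v) (childEdges′ v ++ parentEdges′ v)
        ↭⟨ map⁺ _ (↭-sym (filter-partition-↭ (λ e → o′ e ≟V v) (incident v))) ⟩
      map (l ∘ opposite v) (incident v)
        ↭⟨ neighbourLabels v ⟩
      M (l v) ∎)
      where
      open PermutationReasoning
      children-opposite : map (l ∘ t′) (childEdges′ v) ≡ map (l ∘ opposite v) (childEdges′ v)
      children-opposite = map-cong-local (All.tabulate (cong l ∘ sym ∘ opposite-o′ ∘ Equivalence.to (∈childEdges′⇔ v _)))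
      parents-opposite : map (l ∘ o′) (parentEdges′ v) ≡ map (l ∘ opposite v) (parentEdges′ v)
      parents-opposite = map-cong-local (All.tabulate (cong l ∘ sym ∘ opposite-t′ ∘ Equivalence.to (∈parentEdges′⇔ v _)))

    rerootedTree : LabelledTree
    rerootedTree = record
      { graph             = reroot G R p
      ; src               = o′
      ; tgt               = t′
      ; O⇔src             = λ e → pick⇔ e (t e) (o e)
      ; T⇔tgt             = λ e → pick⇔ e (o e) (t e)
      ; root              = p
      ; tgt≢root          = t′≢p
      ; tgt-injective     = t′-injective
      ; rootPath          = rootPath′
      ; label             = l
      ; parentLabel       = parentLabel′
      ; parentLabel-root  = parentLabel′-root
      ; parentLabel-tgt   = parentLabel′-t′
      ; childEdges        = λ v → proj₁ (inLabelOrder v)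
      ; childEdges-unique = λ v → Unique-resp-↭ (reordered v) (Unique.filter⁺ (λ e → o′ e ≟V v) (incident-unique v))
      ; ∈childEdges⇔      = λ v e → Compose.equivalence (mk⇔ (∈-resp-↭ (↭-sym (reordered v))) (∈-resp-↭ (reordered v)))
                                                        (∈childEdges′⇔ v e)
      ; childEdges-labels = λ v → sym (proj₁ (proj₂ (inLabelOrder v)))
      }
      where
      inLabelOrder : ∀ v → ∃[ es ] children (l v) (parentLabel′ v) ≡ map (l ∘ t′) es × childEdges′ v ↭ es
      inLabelOrder v = ↭-map-inv (l ∘ t′) (childEdges′-labels v)
      reordered : ∀ v → childEdges′ v ↭ proj₁ (inLabelOrder v)
      reordered v = proj₂ (proj₂ (inLabelOrder v))

    reroot≅unfold : reroot G R p ≅ unfold (l p)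
    reroot≅unfold = labelledTree≅unfold rerootedTree

lemma6 : (G : Graph) (R : Graph.V G) → IsRootedTree G R →
    (L : ActualLabelling G R) →
    (∀ p q → ActualLabelling.l L p ≡ ActualLabelling.l L q →
      reroot G R p ≅ reroot G R q)
    × Cocompact G R
lemma6 G R tree L = reroots-≅ , (k , l , reroots-≅)
  where
  open ActualLabelling L
  open Labelled G R tree L using (reroot≅unfold)
  reroots-≅ : ∀ p q → l p ≡ l q → reroot G R p ≅ reroot G R q
  reroots-≅ p q lp≡lq = ≅-trans (reroot≅unfold p)
    (subst (λ a → Unfolding.unfold M a ≅ reroot G R q) (sym lp≡lq) (≅-sym (reroot≅unfold q)))
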